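{- Let $(a,g,f)$ be an almost-Riordan array. Then its inverse (with respect to the product of almost-Riordan arrays, whose identity is $(1,1,x)$) is the almost-Riordan array $$(a,g,f)^{ -1}=\left(a^*,\ \frac{1}{g(\bar f(x))},\ \bar f(x)\right),$$ where $a^*(x)=(1,-g,f)^{ -1}\cdot a(x)$, i.e. $a^*$ is obtained by applying to the coefficient vector of $a$ the inverse of the lower-triangular matrix built from the triple $(1,-g,f)$ by the same rule as for almost-Riordan arrays; explicitly $(1,-g,f)^{ -1}=\left(1,-\frac{1}{g(\bar f)},\bar f\right)$, so that $a^*(x)=1-\frac{x}{g(\bar f(x))}\,\tilde a(\bar f(x))$.
   Context: All power series have integer coefficients. For a power series $h(x)=\sum h_nx^n$ write $\tilde h(x)=(h(x)-h_0)/x$. For $f$ with $f_0=0$, $f_1=1$, $\bar f$ denotes its series reversion, i.e. the power series $u$ with $u(0)=0$ and $f(u(x))=x$. An almost-Riordan array is an ordered triple $(a,g,f)$ of power series with $a_0=1$, $g_0=1$, $f_0=0$, $f_1=1$. A triple $(a,g,f)$ (also with $g_0=-1$ allowed for matrix purposes) is identified with the infinite lower-triangular matrix $M$ given by $M_{n,0}=a_n$, $M_{0,k}=0$ for $k\ge 1$, and $M_{n,k}=[x^{n-1}]\,g(x)f(x)^{k-1}$ for $n,k\ge 1$. For a power series $h$, $(a,g,f)\cdot h$ denotes the power series whose coefficient sequence is $M\,(h_0,h_1,\dots)^T$. The product of almost-Riordan arrays is $(a,g,f)\cdot(b,u,v)=\big((a,g,f)\cdot b,\ g(x)u(f(x)),\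 v(f(x))\big)$, with identity $(1,1,x)$. -}

module Defs where

open import Data.Nat using (ℕ; zero; suc; _∸_)
open import Data.Integer using (ℤ; _+_; _*_; -_; 0ℤ; 1ℤ)
open import Data.Product using (_×_)
open import Relation.Binary.PropositionalEquality using (_≡_)

Series : Set
Series = ℕ → ℤ

_≐_ : Series → Series → Set
s ≐ t = ∀ n → s n ≡ t n
infix 4 _≐_

sumTo : ℕ → (ℕ → ℤ) → ℤ
sumTo zero    h = h zero
sumTo (suc n) h = sumTo n h + h (suc n)

one : Series
one zero = 1ℤ
one (suc _) = 0ℤ

X : Series
X (suc zero) = 1ℤ
X _ = 0ℤ

neg : Series → Series
neg s n = - s n

mul : Series → Series → Series
mul s t n = sumTo n (λ i → s i * t (n ∸ i))

pow : Series → ℕ → Series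
pow s zero    = one
pow s (suc k) = mul s (pow s k)

-- composition h(f(x)), meaningful when f 0 = 0 (then the sum is exact)
comp : Series → Series → Series
comp h f n = sumTo n (λ k → h k * pow f k n)

-- h~(x) = (h(x) - h_0)/x
tilde : Series → Series
tilde h n = h (suc n)

record Triple : Set where
  constructor ⟨_,_,_⟩
  field
    fst : Series
    snd : Series
    thd : Series
open Triple public

IsAlmostRiordan : Triple → Set
IsAlmostRiordan T = (fst T 0 ≡ 1ℤ) × (snd T 0 ≡ 1ℤ) × (thd T 0 ≡ 0ℤ) × (thd T 1 ≡ 1ℤ)

arMat : Triple → ℕ → ℕ → ℤ
arMat T n       zero    = fst T n
arMat T zero    (suc k) = 0ℤ
arMat T (suc n) (suc k) = mul (snd T) (pow (thd T) k) n

-- T · h : the series with coefficient vector M (h_0, h_1, ...)^T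
-- (M is lower triangular when thd T 0 = 0, so the sum over k ≤ n is exact)
act : Triple → Series → Series
act T h n = sumTo n (λ k → arMat T n k * h k)

Matrix : Set
Matrix = ℕ → ℕ → ℤ

matMul : Matrix → Matrix → Matrix
matMul A B n k = sumTo n (λ j → A n j * B j k)

idMat : Matrix
idMat zero    zero    = 1ℤ
idMat zero    (suc _) = 0ℤ
idMat (suc _) zero    = 0ℤ
idMat (suc n) (suc k) = idMat n k

_≐M_ : Matrix → Matrix → Set
A ≐M B = ∀ n k → A n k ≡ B n k
infix 4 _≐M_

_⊙_ : Triple → Triple → Triple
T ⊙ S = ⟨ act T (fst S) , mul (snd T) (comp (snd S) (thd T)) , comp (thd S) (thd T) ⟩
infixl 7 _⊙_

idAR : Triple
idAR = ⟨ one , one , X ⟩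

_≐T_ : Triple → Triple → Set
T ≐T S = (fst T ≐ fst S) × (snd T ≐ snd S) × (thd T ≐ thd S)
infix 4 _≐T_

IsReversion : Series → Series → Set
IsReversion f u = (u 0 ≡ 0ℤ) × (comp f u ≐ X)

-- Composition h ↦ h(u) with u(0) = 0 is multiplicative, (h k)(u) = h(u) k(u), and from this the matrix
-- of an almost-Riordan array is multiplicative: M(T) M(S) = M(T ⊙ S). So (1, -1/g(f̄), f̄) ⊙ (1, -g, f)
-- = (1, 1, x) makes the matrix of (1, -1/g(f̄), f̄) a left inverse of that of (1, -g, f). A lower
-- triangular matrix whose diagonal entries are units is left cancellable, so it is a right inverse as
-- well, and reading off (1, -g, f) ⊙ (1, -1/g(f̄), f̄) = (1, 1, x) gives g(x)·(1/g(f̄))(f(x)) = 1 and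
-- f̄(f(x)) = x. The first components of both products are then computed with the fundamental theorem
-- (a, g, f)·h = a h₀ + x g(x) h̃(f(x)).

module Submission where

open import Defs
open import Data.Integer using (ℤ; _-_; 1ℤ; 0ℤ; _+_; _*_; -_)
import Data.Integer.Properties as ℤP
open import Algebra.Properties.AbelianGroup ℤP.+-0-abelianGroup using (∙-cancelˡ)
open import Algebra.Properties.CommutativeSemigroup ℤP.+-commutativeSemigroup using (interchange)
open import Data.Nat using (ℕ; zero; suc; _∸_; _≤_; _<_; z≤n; s≤s)
import Data.Nat.Properties as ℕP
open import Data.Product using (_×_; _,_; proj₁; proj₂)
open import Data.Sum using (inj₁; inj₂)
open import Relation.Nullary using (yes; no)
open import Relation.Binary.PropositionalEquality
import Relation.Binary.Reasoning.Setoid as SetoidReasoning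

module ≐-Reasoning = SetoidReasoning (ℕ →-setoid ℤ)

-- Finite sums and series equality

≐-refl : ∀ {s} → s ≐ s
≐-refl n = refl

≐-sym : ∀ {s t} → s ≐ t → t ≐ s
≐-sym s≐t n = sym (s≐t n)

≐-trans : ∀ {s t u} → s ≐ t → t ≐ u → s ≐ u
≐-trans s≐t t≐u n = trans (s≐t n) (t≐u n)

neg-cong : ∀ {s t} → s ≐ t → neg s ≐ neg t
neg-cong s≐t n = cong -_ (s≐t n)

sumTo-cong : ∀ n {F G : ℕ → ℤ} → (∀ i → i ≤ n → F i ≡ G i) → sumTo n F ≡ sumTo n G
sumTo-cong zero    F≡G = F≡G 0 z≤n
sumTo-cong (suc n) F≡G =
  cong₂ _+_ (sumTo-cong n (λ i i≤n → F≡G i (ℕP.m≤n⇒m≤1+n i≤n))) (F≡G (suc n) ℕP.≤-refl)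

sumTo-zeros : ∀ n {F : ℕ → ℤ} → (∀ i → i ≤ n → F i ≡ 0ℤ) → sumTo n F ≡ 0ℤ
sumTo-zeros zero    F≡0 = F≡0 0 z≤n
sumTo-zeros (suc n) F≡0 =
  cong₂ _+_ (sumTo-zeros n (λ i i≤n → F≡0 i (ℕP.m≤n⇒m≤1+n i≤n))) (F≡0 (suc n) ℕP.≤-refl)

sumTo-sucˡ : ∀ n (F : ℕ → ℤ) → sumTo (suc n) F ≡ F 0 + sumTo n (λ i → F (suc i))
sumTo-sucˡ zero    F = refl
sumTo-sucˡ (suc n) F = trans (cong (_+ F (suc (suc n))) (sumTo-sucˡ n F)) (ℤP.+-assoc (F 0) _ _)

sumTo-+ : ∀ n (F G : ℕ → ℤ) → sumTo n (λ i → F i + G i) ≡ sumTo n F + sumTo n G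
sumTo-+ zero    F G = refl
sumTo-+ (suc n) F G =
  trans (cong (_+ (F (suc n) + G (suc n))) (sumTo-+ n F G))
        (interchange (sumTo n F) (sumTo n G) (F (suc n)) (G (suc n)))

sumTo-*ˡ : ∀ n c (F : ℕ → ℤ) → sumTo n (λ i → c * F i) ≡ c * sumTo n F
sumTo-*ˡ zero    c F = refl
sumTo-*ˡ (suc n) c F =
  trans (cong (_+ (c * F (suc n))) (sumTo-*ˡ n c F)) (sym (ℤP.*-distribˡ-+ c (sumTo n F) (F (suc n))))

sumTo-*ʳ : ∀ n c (F : ℕ → ℤ) → sumTo n (λ i → F i * c) ≡ sumTo n F * c
sumTo-*ʳ n c F =
  trans (sumTo-cong n (λ i _ → ℤP.*-comm (F i) c)) (trans (sumTo-*ˡ n c F) (ℤP.*-comm c _))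

sumTo-neg : ∀ n (F : ℕ → ℤ) → sumTo n (λ i → - F i) ≡ - sumTo n F
sumTo-neg zero    F = refl
sumTo-neg (suc n) F = trans (cong (_+ - F (suc n)) (sumTo-neg n F)) (sym (ℤP.neg-distrib-+ (sumTo n F) (F (suc n))))

sumTo-swap : ∀ n m (F : ℕ → ℕ → ℤ) →
             sumTo n (λ i → sumTo m (F i)) ≡ sumTo m (λ j → sumTo n (λ i → F i j))
sumTo-swap zero    m F = refl
sumTo-swap (suc n) m F =
  trans (cong (_+ sumTo m (F (suc n))) (sumTo-swap n m F))
        (sym (sumTo-+ m (λ j → sumTo n (λ i → F i j)) (F (suc n))))

sumTo-extend : ∀ i n {F : ℕ → ℤ} → i ≤ n → (∀ j → i < j → F j ≡ 0ℤ) → sumTo i F ≡ sumTo n F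
sumTo-extend i zero    z≤n  F≡0 = refl
sumTo-extend i (suc n) {F} i≤1+n F≡0 with ℕP.m≤n⇒m<n∨m≡n i≤1+n
... | inj₂ refl      = refl
... | inj₁ (s≤s i≤n) =
  trans (sumTo-extend i n i≤n F≡0)
        (sym (trans (cong (sumTo n F +_) (F≡0 (suc n) (s≤s i≤n))) (ℤP.+-identityʳ _)))

sumTo-reverse : ∀ n (F : ℕ → ℤ) → sumTo n F ≡ sumTo n (λ i → F (n ∸ i))
sumTo-reverse zero    F = refl
sumTo-reverse (suc n) F =
  trans (cong (_+ F (suc n)) (sumTo-reverse n F))
        (trans (ℤP.+-comm (sumTo n (λ i → F (n ∸ i))) (F (suc n)))
               (sym (sumTo-sucˡ n (λ i → F (suc n ∸ i)))))

-- The ring of power series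

mul-cong : ∀ {s s' t t'} → s ≐ s' → t ≐ t' → mul s t ≐ mul s' t'
mul-cong s≐s' t≐t' n = sumTo-cong n (λ i _ → cong₂ _*_ (s≐s' i) (t≐t' (n ∸ i)))

mul-comm : ∀ s t → mul s t ≐ mul t s
mul-comm s t n =
  trans (sumTo-reverse n (λ i → s i * t (n ∸ i)))
        (sumTo-cong n (λ i i≤n → trans (cong (λ j → s (n ∸ i) * t j) (ℕP.m∸[m∸n]≡n i≤n))
                                       (ℤP.*-comm (s (n ∸ i)) (t i))))

mul-identityˡ : ∀ s → mul one s ≐ s
mul-identityˡ s zero    = ℤP.*-identityˡ (s 0)
mul-identityˡ s (suc n) =
  trans (sumTo-sucˡ n (λ i → one i * s (suc n ∸ i)))
        (trans (cong₂ _+_ (ℤP.*-identityˡ (s (suc n))) (sumTo-zeros n (λ _ _ → refl)))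
               (ℤP.+-identityʳ _))

mul-identityʳ : ∀ s → mul s one ≐ s
mul-identityʳ s = ≐-trans (mul-comm s one) (mul-identityˡ s)

mul-negˡ : ∀ s t → mul (neg s) t ≐ neg (mul s t)
mul-negˡ s t n = trans (sumTo-cong n (λ i _ → sym (ℤP.neg-distribˡ-* (s i) _))) (sumTo-neg n _)

mul-negʳ : ∀ s t → mul s (neg t) ≐ neg (mul s t)
mul-negʳ s t n = trans (sumTo-cong n (λ i _ → sym (ℤP.neg-distribʳ-* (s i) _))) (sumTo-neg n _)

mul-neg-neg : ∀ s t → mul (neg s) (neg t) ≐ mul s t
mul-neg-neg s t n =
  trans (mul-negˡ s (neg t) n) (trans (cong -_ (mul-negʳ s t n)) (ℤP.neg-involutive _))

pow-cong : ∀ {s s'} → s ≐ s' → ∀ k → pow s k ≐ pow s' k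
pow-cong s≐s' zero    = ≐-refl
pow-cong s≐s' (suc k) = mul-cong s≐s' (pow-cong s≐s' k)

OrderAtLeast : ℕ → Series → Set
OrderAtLeast k s = ∀ m → m < k → s m ≡ 0ℤ

mul-orderʳ : ∀ {k} s {t} → OrderAtLeast k t → OrderAtLeast k (mul s t)
mul-orderʳ s {t} ord-t j j<k = sumTo-zeros j (λ i _ →
  trans (cong (s i *_) (ord-t (j ∸ i) (ℕP.≤-<-trans (ℕP.m∸n≤m j i) j<k))) (ℤP.*-zeroʳ (s i)))

mul-order-suc : ∀ {k s t} → s 0 ≡ 0ℤ → OrderAtLeast k t → OrderAtLeast (suc k) (mul s t)
mul-order-suc {k} {s} {t} s₀ ord-t j j≤k = sumTo-zeros j (term j j≤k)
  where
  term : ∀ j → j < suc k → ∀ i → i ≤ j → s i * t (j ∸ i) ≡ 0ℤ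
  term j       _         zero    _         = cong (_* t j) s₀
  term (suc j) (s≤s j<k) (suc i) (s≤s i≤j) =
    trans (cong (s (suc i) *_) (ord-t (j ∸ i) (ℕP.≤-<-trans (ℕP.m∸n≤m j i) j<k)))
          (ℤP.*-zeroʳ (s (suc i)))

pow-order : ∀ u → u 0 ≡ 0ℤ → ∀ k → OrderAtLeast k (pow u k)
pow-order u u₀ zero    m ()
pow-order u u₀ (suc k) = mul-order-suc {s = u} u₀ (pow-order u u₀ k)

-- Lower-triangular matrices

app : Matrix → Series → Series
app A h n = sumTo n (λ k → A n k * h k)

LowerTriangular : Matrix → Set
LowerTriangular A = ∀ j k → j < k → A j k ≡ 0ℤ

app-congˡ : ∀ {A A'} → A ≐M A' → ∀ h → app A h ≐ app A' h
app-congˡ A≐A' h n = sumTo-cong n (λ k _ → cong (_* h k) (A≐A' n k))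

app-congʳ : ∀ A {h h'} → h ≐ h' → app A h ≐ app A h'
app-congʳ A h≐h' n = sumTo-cong n (λ k _ → cong (A n k *_) (h≐h' k))

matMul-congˡ : ∀ {A A'} B → A ≐M A' → matMul A B ≐M matMul A' B
matMul-congˡ B A≐A' n k = sumTo-cong n (λ j _ → cong (_* B j k) (A≐A' n j))

matMul-assoc : ∀ A {B} C → LowerTriangular B → ∀ n k →
               matMul (matMul A B) C n k ≡ matMul A (matMul B C) n k
matMul-assoc A {B} C B-lt n k = begin
  sumTo n (λ j → sumTo n (λ i → A n i * B i j) * C j k)
    ≡⟨ sumTo-cong n (λ j _ → sym (sumTo-*ʳ n (C j k) (λ i → A n i * B i j))) ⟩
  sumTo n (λ j → sumTo n (λ i → A n i * B i j * C j k))
    ≡⟨ sumTo-swap n n (λ j i → A n i * B i j * C j k) ⟩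
  sumTo n (λ i → sumTo n (λ j → A n i * B i j * C j k))
    ≡⟨ sumTo-cong n (λ i i≤n → row i i≤n) ⟩
  sumTo n (λ i → A n i * sumTo i (λ j → B i j * C j k))
    ∎
  where
  open ≡-Reasoning
  -- the inner sum over j ≤ n stops at j = i because B is lower triangular
  row : ∀ i → i ≤ n → sumTo n (λ j → A n i * B i j * C j k) ≡ A n i * sumTo i (λ j → B i j * C j k)
  row i i≤n = begin
    sumTo n (λ j → A n i * B i j * C j k)   ≡⟨ sumTo-cong n (λ j _ → ℤP.*-assoc (A n i) (B i j) (C j k)) ⟩
    sumTo n (λ j → A n i * (B i j * C j k)) ≡⟨ sumTo-*ˡ n (A n i) (λ j → B i j * C j k) ⟩
    A n i * sumTo n (λ j → B i j * C j k)   ≡⟨ cong (A n i *_) (sym (sumTo-extend i n i≤n vanish)) ⟩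
    A n i * sumTo i (λ j → B i j * C j k)   ∎
    where
    vanish : ∀ j → i < j → B i j * C j k ≡ 0ℤ
    vanish j i<j = cong (_* C j k) (B-lt i j i<j)

app-assoc : ∀ A {B} h → LowerTriangular B → ∀ n → app (matMul A B) h n ≡ app A (app B h) n
app-assoc A h B-lt n = matMul-assoc A (λ j _ → h j) B-lt n 0

idMat-diagonal : ∀ n → idMat n n ≡ 1ℤ
idMat-diagonal zero    = refl
idMat-diagonal (suc n) = idMat-diagonal n

app-identity : ∀ h → app idMat h ≐ h
app-identity h zero    = ℤP.*-identityˡ (h 0)
app-identity h (suc n) =
  trans (sumTo-sucˡ n (λ k → idMat (suc n) k * h k))
        (trans (ℤP.+-identityˡ _) (app-identity (λ k → h (suc k)) n))

sumTo-*idMat : ∀ n k (F : ℕ → ℤ) → k ≤ n → sumTo n (λ j → F j * idMat j k) ≡ F k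
sumTo-*idMat zero    zero    F z≤n       = ℤP.*-identityʳ (F 0)
sumTo-*idMat (suc n) zero    F _         =
  trans (sumTo-sucˡ n (λ j → F j * idMat j 0))
        (trans (cong₂ _+_ (ℤP.*-identityʳ (F 0)) (sumTo-zeros n (λ j _ → ℤP.*-zeroʳ (F (suc j)))))
               (ℤP.+-identityʳ (F 0)))
sumTo-*idMat (suc n) (suc k) F (s≤s k≤n) =
  trans (sumTo-sucˡ n (λ j → F j * idMat j (suc k)))
        (trans (cong (_+ sumTo n (λ j → F (suc j) * idMat j k)) (ℤP.*-zeroʳ (F 0)))
               (trans (ℤP.+-identityˡ _) (sumTo-*idMat n k (λ j → F (suc j)) k≤n)))

sumTo-*idMat-beyond : ∀ n k (F : ℕ → ℤ) → n < k → sumTo n (λ j → F j * idMat j k) ≡ 0ℤ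
sumTo-*idMat-beyond zero    (suc k) F _         = ℤP.*-zeroʳ (F 0)
sumTo-*idMat-beyond (suc n) (suc k) F (s≤s n<k) =
  trans (sumTo-sucˡ n (λ j → F j * idMat j (suc k)))
        (cong₂ _+_ (ℤP.*-zeroʳ (F 0)) (sumTo-*idMat-beyond n k (λ j → F (suc j)) n<k))

matMul-identityˡ : ∀ B → matMul idMat B ≐M B
matMul-identityˡ B n k = app-identity (λ j → B j k) n

matMul-identityʳ : ∀ {A} → LowerTriangular A → matMul A idMat ≐M A
matMul-identityʳ {A} A-lt n k with k ℕP.≤? n
... | yes k≤n = sumTo-*idMat n k (A n) k≤n
... | no  k≰n = trans (sumTo-*idMat-beyond n k (A n) (ℕP.≰⇒> k≰n)) (sym (A-lt n k (ℕP.≰⇒> k≰n)))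

matMul-diagonal : ∀ A {B} → LowerTriangular B → ∀ n → matMul A B n n ≡ A n n * B n n
matMul-diagonal A     B-lt zero    = refl
matMul-diagonal A {B} B-lt (suc n) =
  trans (cong (_+ A (suc n) (suc n) * B (suc n) (suc n)) (sumTo-zeros n above))
        (ℤP.+-identityˡ _)
  where
  above : ∀ j → j ≤ n → A (suc n) j * B j (suc n) ≡ 0ℤ
  above j j≤n = trans (cong (A (suc n) j *_) (B-lt j (suc n) (s≤s j≤n))) (ℤP.*-zeroʳ (A (suc n) j))

*-cancelˡ-unit : ∀ d e {x y} → e * d ≡ 1ℤ → d * x ≡ d * y → x ≡ y
*-cancelˡ-unit d e {x} {y} ed≡1 dx≡dy = begin
  x           ≡⟨ sym (ℤP.*-identityˡ x) ⟩
  1ℤ * x      ≡⟨ cong (_* x) (sym ed≡1) ⟩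
  e * d * x   ≡⟨ ℤP.*-assoc e d x ⟩
  e * (d * x) ≡⟨ cong (e *_) dx≡dy ⟩
  e * (d * y) ≡⟨ sym (ℤP.*-assoc e d y) ⟩
  e * d * y   ≡⟨ cong (_* y) ed≡1 ⟩
  1ℤ * y      ≡⟨ ℤP.*-identityˡ y ⟩
  y           ∎
  where open ≡-Reasoning

matMul-cancelˡ : ∀ {A D D'} (e : ℕ → ℤ) → (∀ n → e n * A n n ≡ 1ℤ) →
                 matMul A D ≐M matMul A D' → D ≐M D'
matMul-cancelˡ {A} {D} {D'} e unit AD≐AD' n k = rows n n ℕP.≤-refl
  where
  -- Row n of A D is Σ_{j<n} A n j D j k + A n n D n k, and A n n is a unit.
  rows : ∀ n j → j ≤ n → D j k ≡ D' j k
  rows zero    zero z≤n   = *-cancelˡ-unit (A 0 0) (e 0) (unit 0) (AD≐AD' 0 k)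
  rows (suc n) j    j≤1+n with ℕP.m≤n⇒m<n∨m≡n j≤1+n
  ... | inj₁ (s≤s j≤n) = rows n j j≤n
  ... | inj₂ refl      =
    *-cancelˡ-unit (A (suc n) (suc n)) (e (suc n)) (unit (suc n))
                   (∙-cancelˡ (sumTo n (λ j → A (suc n) j * D j k)) _ _ sameLastTerm)
    where
    sameLastTerm : sumTo n (λ j → A (suc n) j * D j k) + A (suc n) (suc n) * D (suc n) k
                 ≡ sumTo n (λ j → A (suc n) j * D j k) + A (suc n) (suc n) * D' (suc n) k
    sameLastTerm =
      trans (AD≐AD' (suc n) k)
            (cong (_+ _) (sumTo-cong n (λ j j≤n → cong (A (suc n) j *_) (sym (rows n j j≤n)))))

leftInverse⇒rightInverse : ∀ {A B} → LowerTriangular A → LowerTriangular B →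
                           matMul A B ≐M idMat → matMul B A ≐M idMat
leftInverse⇒rightInverse {A} {B} A-lt B-lt AB≐I =
  matMul-cancelˡ {A = A} {D = matMul B A} {D' = idMat} (λ n → B n n) unit A[BA]≐AI
  where
  unit : ∀ n → B n n * A n n ≡ 1ℤ
  unit n = trans (ℤP.*-comm (B n n) (A n n))
                 (trans (sym (matMul-diagonal A B-lt n)) (trans (AB≐I n n) (idMat-diagonal n)))
  A[BA]≐AI : matMul A (matMul B A) ≐M matMul A idMat
  A[BA]≐AI n k =
    trans (sym (matMul-assoc A A B-lt n k))
          (trans (matMul-congˡ A AB≐I n k)
                 (trans (matMul-identityˡ A n k) (sym (matMul-identityʳ A-lt n k))))

-- Multiplication by a series as a Toeplitz matrix

toeplitz : Series → Matrix
toeplitz s zero    zero    = s 0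
toeplitz s zero    (suc k) = 0ℤ
toeplitz s (suc n) zero    = s (suc n)
toeplitz s (suc n) (suc k) = toeplitz s n k

toeplitz-col₀ : ∀ s n → toeplitz s n 0 ≡ s n
toeplitz-col₀ s zero    = refl
toeplitz-col₀ s (suc n) = refl

toeplitz-≤ : ∀ s n k → k ≤ n → toeplitz s n k ≡ s (n ∸ k)
toeplitz-≤ s n       zero    _         = toeplitz-col₀ s n
toeplitz-≤ s (suc n) (suc k) (s≤s k≤n) = toeplitz-≤ s n k k≤n

toeplitz-LT : ∀ s → LowerTriangular (toeplitz s)
toeplitz-LT s zero    (suc k) _         = refl
toeplitz-LT s (suc n) (suc k) (s≤s n<k) = toeplitz-LT s n k n<k

mul≡app-toeplitz : ∀ s t n → mul s t n ≡ app (toeplitz s) t n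
mul≡app-toeplitz s t n =
  trans (mul-comm s t n)
        (sumTo-cong n (λ i i≤n → trans (ℤP.*-comm (t i) (s (n ∸ i)))
                                       (cong (_* t i) (sym (toeplitz-≤ s n i i≤n)))))

toeplitz-mul : ∀ s t → matMul (toeplitz s) (toeplitz t) ≐M toeplitz (mul s t)
toeplitz-mul s t n zero =
  trans (sumTo-cong n (λ j _ → cong (toeplitz s n j *_) (toeplitz-col₀ t j)))
        (trans (sym (mul≡app-toeplitz s t n)) (sym (toeplitz-col₀ (mul s t) n)))
toeplitz-mul s t zero    (suc k) = ℤP.*-zeroʳ (s 0)
toeplitz-mul s t (suc n) (suc k) =
  trans (sumTo-sucˡ n (λ j → toeplitz s (suc n) j * toeplitz t j (suc k)))
        (trans (cong (_+ matMul (toeplitz s) (toeplitz t) n k) (ℤP.*-zeroʳ (s (suc n))))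
               (trans (ℤP.+-identityˡ _) (toeplitz-mul s t n k)))

mul-assoc : ∀ s t w → mul (mul s t) w ≐ mul s (mul t w)
mul-assoc s t w n = begin
  mul (mul s t) w n                             ≡⟨ mul≡app-toeplitz (mul s t) w n ⟩
  app (toeplitz (mul s t)) w n                  ≡⟨ app-congˡ (λ i k → sym (toeplitz-mul s t i k)) w n ⟩
  app (matMul (toeplitz s) (toeplitz t)) w n    ≡⟨ app-assoc (toeplitz s) w (toeplitz-LT t) n ⟩
  app (toeplitz s) (app (toeplitz t) w) n       ≡⟨ app-congʳ (toeplitz s) (λ k → sym (mul≡app-toeplitz t w k)) n ⟩
  app (toeplitz s) (mul t w) n                  ≡⟨ sym (mul≡app-toeplitz s (mul t w) n) ⟩
  mul s (mul t w) n                             ∎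
  where open ≡-Reasoning

mul-leftComm : ∀ s t w → mul s (mul t w) ≐ mul t (mul s w)
mul-leftComm s t w =
  ≐-trans (≐-sym (mul-assoc s t w)) (≐-trans (mul-cong (mul-comm s t) (≐-refl {w})) (mul-assoc t s w))

-- Composition of power series

powMat : Series → Matrix
powMat u n k = pow u k n

powMat-LT : ∀ {u} → u 0 ≡ 0ℤ → LowerTriangular (powMat u)
powMat-LT {u} u₀ j k j<k = pow-order u u₀ k j j<k

comp≐app-powMat : ∀ h u → comp h u ≐ app (powMat u) h
comp≐app-powMat h u n = sumTo-cong n (λ k _ → ℤP.*-comm (h k) (pow u k n))

comp-congˡ : ∀ {h h'} u → h ≐ h' → comp h u ≐ comp h' u
comp-congˡ u h≐h' n = sumTo-cong n (λ k _ → cong (_* pow u k n) (h≐h' k))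

mul-comp : ∀ s h {u} → u 0 ≡ 0ℤ → ∀ n →
           mul s (comp h u) n ≡ sumTo n (λ k → mul s (pow u k) n * h k)
mul-comp s h {u} u₀ n = begin
  mul s (comp h u) n                       ≡⟨ mul≡app-toeplitz s (comp h u) n ⟩
  app (toeplitz s) (comp h u) n            ≡⟨ app-congʳ (toeplitz s) (comp≐app-powMat h u) n ⟩
  app (toeplitz s) (app (powMat u) h) n    ≡⟨ sym (app-assoc (toeplitz s) h (powMat-LT u₀) n) ⟩
  app (matMul (toeplitz s) (powMat u)) h n ≡⟨ app-congˡ (λ m k → sym (mul≡app-toeplitz s (pow u k) m)) h n ⟩
  sumTo n (λ k → mul s (pow u k) n * h k)  ∎
  where open ≡-Reasoning

timesX : Series → Series
timesX h zero    = 0ℤ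
timesX h (suc n) = h n

sumTo-timesX : ∀ n h (G : ℕ → ℤ) → G (suc n) ≡ 0ℤ →
               sumTo n (λ k → timesX h k * G k) ≡ sumTo n (λ k → h k * G (suc k))
sumTo-timesX zero    h G G₁≡0 = sym (trans (cong (h 0 *_) G₁≡0) (ℤP.*-zeroʳ (h 0)))
sumTo-timesX (suc n) h G G₂₊ₙ≡0 = begin
  sumTo (suc n) (λ k → timesX h k * G k)      ≡⟨ sumTo-sucˡ n (λ k → timesX h k * G k) ⟩
  0ℤ + sumTo n (λ k → h k * G (suc k))        ≡⟨ ℤP.+-identityˡ _ ⟩
  sumTo n (λ k → h k * G (suc k))             ≡⟨ sym (ℤP.+-identityʳ _) ⟩
  sumTo n (λ k → h k * G (suc k)) + 0ℤ        ≡⟨ cong (sumTo n (λ k → h k * G (suc k)) +_) (sym lastTerm) ⟩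
  sumTo (suc n) (λ k → h k * G (suc k))       ∎
  where
  open ≡-Reasoning
  lastTerm : h (suc n) * G (suc (suc n)) ≡ 0ℤ
  lastTerm = trans (cong (h (suc n) *_) G₂₊ₙ≡0) (ℤP.*-zeroʳ (h (suc n)))

comp-timesX : ∀ h {u} → u 0 ≡ 0ℤ → comp (timesX h) u ≐ mul u (comp h u)
comp-timesX h {u} u₀ n = begin
  comp (timesX h) u n
    ≡⟨ sumTo-timesX n h (λ k → pow u k n) (pow-order u u₀ (suc n) n ℕP.≤-refl) ⟩
  sumTo n (λ k → h k * pow u (suc k) n)  ≡⟨ sumTo-cong n (λ k _ → ℤP.*-comm (h k) (pow u (suc k) n)) ⟩
  sumTo n (λ k → pow u (suc k) n * h k)  ≡⟨ sym (mul-comp u h u₀ n) ⟩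
  mul u (comp h u) n                     ∎
  where open ≡-Reasoning

toeplitz-col-suc : ∀ h j → (λ m → toeplitz h m (suc j)) ≐ timesX (λ m → toeplitz h m j)
toeplitz-col-suc h j zero    = refl
toeplitz-col-suc h j (suc m) = refl

comp-toeplitz-col : ∀ h {u} → u 0 ≡ 0ℤ → ∀ j →
                    comp (λ m → toeplitz h m j) u ≐ mul (comp h u) (pow u j)
comp-toeplitz-col h {u} u₀ zero    =
  ≐-trans (comp-congˡ u (toeplitz-col₀ h)) (≐-sym (mul-identityʳ (comp h u)))
comp-toeplitz-col h {u} u₀ (suc j) = begin
  comp (λ m → toeplitz h m (suc j)) u       ≈⟨ comp-congˡ u (toeplitz-col-suc h j) ⟩
  comp (timesX (λ m → toeplitz h m j)) u    ≈⟨ comp-timesX (λ m → toeplitz h m j) u₀ ⟩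
  mul u (comp (λ m → toeplitz h m j) u)     ≈⟨ mul-cong (≐-refl {u}) (comp-toeplitz-col h u₀ j) ⟩
  mul u (mul (comp h u) (pow u j))          ≈⟨ mul-leftComm u (comp h u) (pow u j) ⟩
  mul (comp h u) (pow u (suc j))            ∎
  where open ≐-Reasoning

comp-mul : ∀ h k {u} → u 0 ≡ 0ℤ → comp (mul h k) u ≐ mul (comp h u) (comp k u)
comp-mul h k {u} u₀ n = begin
  comp (mul h k) u n                                ≡⟨ comp≐app-powMat (mul h k) u n ⟩
  app (powMat u) (mul h k) n                        ≡⟨ app-congʳ (powMat u) (mul≡app-toeplitz h k) n ⟩
  app (powMat u) (app (toeplitz h) k) n             ≡⟨ sym (app-assoc (powMat u) k (toeplitz-LT h) n) ⟩
  app (matMul (powMat u) (toeplitz h)) k n          ≡⟨ app-congˡ entries k n ⟩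
  sumTo n (λ j → mul (comp h u) (pow u j) n * k j)  ≡⟨ sym (mul-comp (comp h u) k u₀ n) ⟩
  mul (comp h u) (comp k u) n                       ∎
  where
  open ≡-Reasoning
  entries : matMul (powMat u) (toeplitz h) ≐M (λ m j → mul (comp h u) (pow u j) m)
  entries m j = trans (sym (comp≐app-powMat (λ i → toeplitz h i j) u m)) (comp-toeplitz-col h u₀ j m)

comp-one : ∀ u → comp one u ≐ one
comp-one u zero    = refl
comp-one u (suc n) =
  trans (sumTo-sucˡ n (λ k → one k * pow u k (suc n))) (cong (0ℤ +_) (sumTo-zeros n (λ _ _ → refl)))

comp-pow : ∀ s {u} → u 0 ≡ 0ℤ → ∀ k → comp (pow s k) u ≐ pow (comp s u) k
comp-pow s {u} u₀ zero    = comp-one u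
comp-pow s {u} u₀ (suc k) =
  ≐-trans (comp-mul s (pow s k) u₀) (mul-cong (≐-refl {comp s u}) (comp-pow s u₀ k))

comp-neg : ∀ h u → comp (neg h) u ≐ neg (comp h u)
comp-neg h u n =
  trans (sumTo-cong n (λ k _ → sym (ℤP.neg-distribˡ-* (h k) (pow u k n)))) (sumTo-neg n _)

mul-X : ∀ s → mul X s ≐ timesX s
mul-X s zero    = refl
mul-X s (suc n) =
  trans (sumTo-sucˡ n (λ i → X i * s (suc n ∸ i)))
        (trans (ℤP.+-identityˡ _) (trans (mul-cong tildeX≐one (≐-refl {s}) n) (mul-identityˡ s n)))
  where
  tildeX≐one : tilde X ≐ one
  tildeX≐one zero    = refl
  tildeX≐one (suc n) = refl

pow-X : ∀ k n → pow X k n ≡ idMat n k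
pow-X zero    zero    = refl
pow-X zero    (suc n) = refl
pow-X (suc k) zero    = refl
pow-X (suc k) (suc n) = trans (mul-X (pow X k) (suc n)) (pow-X k n)

comp-X : ∀ h → comp h X ≐ h
comp-X h n =
  trans (comp≐app-powMat h X n) (trans (app-congˡ (λ m k → pow-X k m) h n) (app-identity h n))

-- Almost-Riordan arrays

arMat-LT : ∀ T → thd T 0 ≡ 0ℤ → LowerTriangular (arMat T)
arMat-LT T f₀ zero    (suc k) _         = refl
arMat-LT T f₀ (suc j) (suc k) (s≤s j<k) = mul-orderʳ (snd T) (pow-order (thd T) f₀ k) j j<k

arMat-cong : ∀ {T S} → T ≐T S → arMat T ≐M arMat S
arMat-cong (a≐b , _ , _)     n       zero    = a≐b n
arMat-cong _                 zero    (suc k) = refl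
arMat-cong (_ , g≐u , f≐v) (suc n) (suc k) = mul-cong g≐u (pow-cong f≐v k) n

act-cong : ∀ {T S} → T ≐T S → ∀ h → act T h ≐ act S h
act-cong T≐S = app-congˡ (arMat-cong T≐S)

act-one : ∀ T → act T one ≐ fst T
act-one T n = trans (app-congʳ (arMat T) (pow-X 0) n) (sumTo-*idMat n 0 (arMat T n) z≤n)

act-suc : ∀ T h → thd T 0 ≡ 0ℤ → ∀ n →
          act T h (suc n) ≡ fst T (suc n) * h 0 + mul (snd T) (comp (tilde h) (thd T)) n
act-suc T h f₀ n =
  trans (sumTo-sucˡ n (λ k → arMat T (suc n) k * h k))
        (cong (fst T (suc n) * h 0 +_) (sym (mul-comp (snd T) (tilde h) f₀ n)))

arMat-⊙ : ∀ T S → thd T 0 ≡ 0ℤ → matMul (arMat T) (arMat S) ≐M arMat (T ⊙ S)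
arMat-⊙ T S f₀ n       zero    = refl
arMat-⊙ T S f₀ zero    (suc k) = ℤP.*-zeroʳ (fst T 0)
arMat-⊙ T S f₀ (suc n) (suc k) = begin
  act T (λ j → arMat S j (suc k)) (suc n)
    ≡⟨ act-suc T (λ j → arMat S j (suc k)) f₀ n ⟩
  fst T (suc n) * 0ℤ + mul g (comp (mul u (pow v k)) f) n
    ≡⟨ cong (_+ mul g (comp (mul u (pow v k)) f) n) (ℤP.*-zeroʳ (fst T (suc n))) ⟩
  0ℤ + mul g (comp (mul u (pow v k)) f) n
    ≡⟨ ℤP.+-identityˡ _ ⟩
  mul g (comp (mul u (pow v k)) f) n
    ≡⟨ mul-cong (≐-refl {g}) (≐-trans (comp-mul u (pow v k) f₀)
                                      (mul-cong (≐-refl {comp u f}) (comp-pow v f₀ k))) n ⟩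
  mul g (mul (comp u f) (pow (comp v f) k)) n
    ≡⟨ sym (mul-assoc g (comp u f) (pow (comp v f) k) n) ⟩
  mul (mul g (comp u f)) (pow (comp v f) k) n
    ∎
  where
  open ≡-Reasoning
  g f u v : Series
  g = snd T
  f = thd T
  u = snd S
  v = thd S

act-⊙ : ∀ T S → thd T 0 ≡ 0ℤ → thd S 0 ≡ 0ℤ → ∀ h → act T (act S h) ≐ act (T ⊙ S) h
act-⊙ T S f₀ v₀ h n =
  trans (sym (app-assoc (arMat T) h (arMat-LT S v₀) n)) (app-congˡ (arMat-⊙ T S f₀) h n)

arMat-idAR : arMat idAR ≐M idMat
arMat-idAR n       zero    = pow-X 0 n
arMat-idAR zero    (suc k) = refl
arMat-idAR (suc n) (suc k) = trans (mul-identityˡ (pow X k) n) (pow-X k n)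

arMat≐idMat⇒≐idAR : ∀ T → arMat T ≐M idMat → T ≐T idAR
arMat≐idMat⇒≐idAR T M≐I = fst≐one , snd≐one , thd≐X
  where
  open ≡-Reasoning
  fst≐one : fst T ≐ one
  fst≐one n = trans (M≐I n 0) (sym (pow-X 0 n))
  snd≐one : snd T ≐ one
  snd≐one n = trans (sym (mul-identityʳ (snd T) n)) (trans (M≐I (suc n) 1) (sym (pow-X 0 n)))
  thd≐X : thd T ≐ X
  thd≐X n = begin
    thd T n                          ≡⟨ sym (mul-identityʳ (thd T) n) ⟩
    pow (thd T) 1 n                  ≡⟨ sym (mul-identityˡ (pow (thd T) 1) n) ⟩
    mul one (pow (thd T) 1) n        ≡⟨ mul-cong (≐-sym snd≐one) (≐-refl {pow (thd T) 1}) n ⟩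
    arMat T (suc n) 2                ≡⟨ M≐I (suc n) 2 ⟩
    idMat n 1                        ≡⟨ sym (pow-X 1 n) ⟩
    pow X 1 n                        ≡⟨ mul-identityʳ X n ⟩
    X n                              ∎

-- The inverse of an almost-Riordan array

module InverseArray
  (a g f : Series) (a₀ : a 0 ≡ 1ℤ) (g₀ : g 0 ≡ 1ℤ) (f₀ : f 0 ≡ 0ℤ) (f₁ : f 1 ≡ 1ℤ)
  (fbar : Series) (fbar₀ : fbar 0 ≡ 0ℤ) (f∘fbar≐X : comp f fbar ≐ X)
  (ginv : Series) (g∘fbar·ginv≐one : mul (comp g fbar) ginv ≐ one)
  where

  A T₁ T₂ : Triple
  A  = ⟨ a , g , f ⟩
  T₁ = ⟨ one , neg g , f ⟩
  T₂ = ⟨ one , neg ginv , fbar ⟩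

  astar : Series
  astar = act T₂ a

  B : Triple
  B = ⟨ astar , ginv , fbar ⟩

  ginv₀ : ginv 0 ≡ 1ℤ
  ginv₀ = begin
    ginv 0                ≡⟨ sym (ℤP.*-identityˡ (ginv 0)) ⟩
    1ℤ * ginv 0           ≡⟨ cong (λ c → c * 1ℤ * ginv 0) (sym g₀) ⟩
    g 0 * 1ℤ * ginv 0     ≡⟨ g∘fbar·ginv≐one 0 ⟩
    1ℤ                    ∎
    where open ≡-Reasoning

  fbar₁ : fbar 1 ≡ 1ℤ
  fbar₁ = begin
    fbar 1                                    ≡⟨ sym (mul-identityʳ fbar 1) ⟩
    pow fbar 1 1                              ≡⟨ sym (ℤP.*-identityˡ (pow fbar 1 1)) ⟩
    1ℤ * pow fbar 1 1                         ≡⟨ cong (_* pow fbar 1 1) (sym f₁) ⟩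
    f 1 * pow fbar 1 1                        ≡⟨ sym (ℤP.+-identityˡ (f 1 * pow fbar 1 1)) ⟩
    0ℤ * 0ℤ + f 1 * pow fbar 1 1              ≡⟨ cong (λ c → c * 0ℤ + f 1 * pow fbar 1 1) (sym f₀) ⟩
    f 0 * pow fbar 0 1 + f 1 * pow fbar 1 1   ≡⟨ f∘fbar≐X 1 ⟩
    1ℤ                                        ∎
    where open ≡-Reasoning

  T₂⊙T₁≐id : T₂ ⊙ T₁ ≐T idAR
  T₂⊙T₁≐id = act-one T₂ , [-ginv]·[-g]∘fbar≐one , f∘fbar≐X
    where
    open ≐-Reasoning
    [-ginv]·[-g]∘fbar≐one : mul (neg ginv) (comp (neg g) fbar) ≐ one
    [-ginv]·[-g]∘fbar≐one = begin
      mul (neg ginv) (comp (neg g) fbar)   ≈⟨ mul-cong (≐-refl {neg ginv}) (comp-neg g fbar) ⟩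
      mul (neg ginv) (neg (comp g fbar))   ≈⟨ mul-neg-neg ginv (comp g fbar) ⟩
      mul ginv (comp g fbar)               ≈⟨ mul-comm ginv (comp g fbar) ⟩
      mul (comp g fbar) ginv               ≈⟨ g∘fbar·ginv≐one ⟩
      one                                  ∎

  M₂M₁≐I : matMul (arMat T₂) (arMat T₁) ≐M idMat
  M₂M₁≐I n k = trans (arMat-⊙ T₂ T₁ fbar₀ n k) (trans (arMat-cong T₂⊙T₁≐id n k) (arMat-idAR n k))

  M₁M₂≐I : matMul (arMat T₁) (arMat T₂) ≐M idMat
  M₁M₂≐I = leftInverse⇒rightInverse (arMat-LT T₂ fbar₀) (arMat-LT T₁ f₀) M₂M₁≐I

  T₁⊙T₂≐id : T₁ ⊙ T₂ ≐T idAR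
  T₁⊙T₂≐id =
    arMat≐idMat⇒≐idAR (T₁ ⊙ T₂) (λ n k → trans (sym (arMat-⊙ T₁ T₂ f₀ n k)) (M₁M₂≐I n k))

  g·ginv∘f≐one : mul g (comp ginv f) ≐ one
  g·ginv∘f≐one = begin
    mul g (comp ginv f)                ≈˘⟨ mul-neg-neg g (comp ginv f) ⟩
    mul (neg g) (neg (comp ginv f))    ≈˘⟨ mul-cong (≐-refl {neg g}) (comp-neg ginv f) ⟩
    mul (neg g) (comp (neg ginv) f)    ≈⟨ proj₁ (proj₂ T₁⊙T₂≐id) ⟩
    one                                ∎
    where open ≐-Reasoning

  fbar∘f≐X : comp fbar f ≐ X
  fbar∘f≐X = proj₂ (proj₂ T₁⊙T₂≐id)

  A⊙T₂≐a-negOne-X : A ⊙ T₂ ≐T ⟨ a , neg one , X ⟩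
  A⊙T₂≐a-negOne-X = act-one A , g·[-ginv]∘f≐-one , fbar∘f≐X
    where
    g·[-ginv]∘f≐-one : mul g (comp (neg ginv) f) ≐ neg one
    g·[-ginv]∘f≐-one =
      ≐-trans (mul-cong (≐-refl {g}) (comp-neg ginv f))
              (≐-trans (mul-negʳ g (comp ginv f)) (neg-cong g·ginv∘f≐one))

  act-a-negOne-X : act ⟨ a , neg one , X ⟩ a ≐ one
  act-a-negOne-X zero    = cong₂ _*_ a₀ a₀
  act-a-negOne-X (suc n) = begin
    act ⟨ a , neg one , X ⟩ a (suc n)                          ≡⟨ act-suc ⟨ a , neg one , X ⟩ a refl n ⟩
    a (suc n) * a 0 + mul (neg one) (comp (tilde a) X) n        ≡⟨ cong₂ _+_ a₍ₙ₊₁₎a₀ [-1]·ã∘X ⟩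
    a (suc n) + - a (suc n)                                     ≡⟨ ℤP.+-inverseʳ (a (suc n)) ⟩
    0ℤ                                                          ∎
    where
    open ≡-Reasoning
    a₍ₙ₊₁₎a₀ : a (suc n) * a 0 ≡ a (suc n)
    a₍ₙ₊₁₎a₀ = trans (cong (a (suc n) *_) a₀) (ℤP.*-identityʳ (a (suc n)))
    [-1]·ã∘X : mul (neg one) (comp (tilde a) X) n ≡ - a (suc n)
    [-1]·ã∘X = trans (mul-negˡ one (comp (tilde a) X) n)
                     (cong -_ (trans (mul-identityˡ (comp (tilde a) X) n) (comp-X (tilde a) n)))

  A⊙B≐id : A ⊙ B ≐T idAR
  A⊙B≐id = ≐-trans (act-⊙ A T₂ f₀ fbar₀ a) (≐-trans (act-cong A⊙T₂≐a-negOne-X a) act-a-negOne-X)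
         , g·ginv∘f≐one , fbar∘f≐X

  astar₀ : astar 0 ≡ 1ℤ
  astar₀ = trans (ℤP.*-identityˡ (a 0)) a₀

  astar-suc : ∀ n → astar (suc n) ≡ - mul ginv (comp (tilde a) fbar) n
  astar-suc n = begin
    act T₂ a (suc n)                                   ≡⟨ act-suc T₂ a fbar₀ n ⟩
    0ℤ + mul (neg ginv) (comp (tilde a) fbar) n        ≡⟨ ℤP.+-identityˡ _ ⟩
    mul (neg ginv) (comp (tilde a) fbar) n             ≡⟨ mul-negˡ ginv (comp (tilde a) fbar) n ⟩
    - mul ginv (comp (tilde a) fbar) n                 ∎
    where open ≡-Reasoning

  B⊙A≐id : B ⊙ A ≐T idAR
  B⊙A≐id = act-B-a , ≐-trans (mul-comm ginv (comp g fbar)) g∘fbar·ginv≐one , f∘fbar≐X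
    where
    act-B-a : act B a ≐ one
    act-B-a zero    = cong₂ _*_ astar₀ a₀
    act-B-a (suc n) = begin
      act B a (suc n)                                  ≡⟨ act-suc B a fbar₀ n ⟩
      astar (suc n) * a 0 + mul ginv ã∘fbar n          ≡⟨ cong (_+ mul ginv ã∘fbar n) astar₍ₙ₊₁₎a₀ ⟩
      - mul ginv ã∘fbar n + mul ginv ã∘fbar n          ≡⟨ ℤP.+-inverseˡ (mul ginv ã∘fbar n) ⟩
      0ℤ                                               ∎
      where
      open ≡-Reasoning
      ã∘fbar : Series
      ã∘fbar = comp (tilde a) fbar
      astar₍ₙ₊₁₎a₀ : astar (suc n) * a 0 ≡ - mul ginv ã∘fbar n
      astar₍ₙ₊₁₎a₀ = trans (cong₂ _*_ (astar-suc n) a₀) (ℤP.*-identityʳ _)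

  astar-explicit : (λ n → one n - mul X (mul ginv (comp (tilde a) fbar)) n) ≐ astar
  astar-explicit zero    = sym astar₀
  astar-explicit (suc n) =
    trans (ℤP.+-identityˡ _)
          (trans (cong -_ (mul-X (mul ginv (comp (tilde a) fbar)) (suc n))) (sym (astar-suc n)))

  B-almostRiordan : IsAlmostRiordan B
  B-almostRiordan = astar₀ , ginv₀ , fbar₀ , fbar₁

mainTheorem4 : (a g f : Series) → IsAlmostRiordan ⟨ a , g , f ⟩ →
    (fbar : Series) → IsReversion f fbar →
    (ginv : Series) → mul (comp g fbar) ginv ≐ one →
    let astar = act ⟨ one , neg ginv , fbar ⟩ a in
    (matMul (arMat ⟨ one , neg g , f ⟩) (arMat ⟨ one , neg ginv , fbar ⟩) ≐M idMat) ×
    (matMul (arMat ⟨ one , neg ginv , fbar ⟩) (arMat ⟨ one , neg g , f ⟩) ≐M idMat) ×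
    ((λ n → one n - mul X (mul ginv (comp (tilde a) fbar)) n) ≐ astar) ×
    IsAlmostRiordan ⟨ astar , ginv , fbar ⟩ ×
    (⟨ a , g , f ⟩ ⊙ ⟨ astar , ginv , fbar ⟩ ≐T idAR) ×
    (⟨ astar , ginv , fbar ⟩ ⊙ ⟨ a , g , f ⟩ ≐T idAR)
mainTheorem4 a g f (a₀ , g₀ , f₀ , f₁) fbar (fbar₀ , f∘fbar≐X) ginv g∘fbar·ginv≐one =
  M₁M₂≐I , M₂M₁≐I , astar-explicit , B-almostRiordan , A⊙B≐id , B⊙A≐id
  where open InverseArray a g f a₀ g₀ f₀ f₁ fbar fbar₀ f∘fbar≐X ginv g∘fbar·ginv≐one
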